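{- Let $f:\{0,1\}^n\to\{0,1\}^n$ be monotone. Then the number of fixed points of $f$ is at most two plus the sum of the $\nu-1$ largest binomial coefficients of order $\tau$ (i.e. of the numbers $\binom{\tau}{k}$, $0\le k\le\tau$), where $\tau$ and $\nu$ are respectively the transversal number and the packing number of the interaction graph $G(f)$.
   Context: For $f:\{0,1\}^n\to\{0,1\}^n$ with components $f_1,\dots,f_n$, the discrete partial derivative is $f_{ij}(x)=f_i(x_1,\dots,x_{j-1},1,x_{j+1},\dots,x_n)-f_i(x_1,\dots,x_{j-1},0,x_{j+1},\dots,x_n)$. The interaction graph $G(f)$ is the signed directed graph on vertex set $[n]$ with a positive (resp. negative) arc $j\to i$ whenever $f_{ij}(x)>0$ (resp. $<0$) for at least one state $x$ (loops allowed). $f$ is monotone if $x\le y$ componentwise implies $f(x)\le f(y)$ componentwise. A fixed point is $x$ with $f(x)=x$. Cycles are directed cycles without repeated vertices. The transversal number $\tau$ of a graph is the minimum size of a set of vertices meeting every cycle (a feedback vertex set); the packing number $\nu$ is the maximum number of pairwise vertex-disjoint cycles. -}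

module Defs where

open import Data.Nat using (ℕ; zero; suc; _+_; _∸_; _≤_)
open import Data.Nat.Properties using (≤-decTotalOrder)
open import Data.Nat.Combinatorics using (_C_)
open import Data.Integer as ℤ using (ℤ; +_; _-_; _<_)
open import Data.Bool using (Bool; true; false; if_then_else_)
import Data.Bool as B
open import Data.Fin using (Fin)
open import Data.Fin.Subset using (Subset; _∈_; _∉_; ∣_∣)
open import Data.Vec using (Vec; []; _∷_; lookup; _[_]≔_)
open import Data.Vec.Properties using (≡-dec)
open import Data.List using (List; []; _∷_; [_]; _++_; length; map; filter; take; reverse; upTo)
open import Data.Nat.ListAction using (sum)
open import Data.List.Relation.Unary.All using (All)
open import Data.List.Relation.Unary.Any using (Any)
open import Data.List.Relation.Unary.AllPairs using (AllPairs)
open import Data.List.Relation.Unary.Unique.Propositional using (Unique)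
open import Data.List.Relation.Unary.Linked using (Linked)
import Data.List.Membership.Propositional as LM
open import Data.List.Sort.MergeSort.Base ≤-decTotalOrder using (sort)
open import Data.Product using (Σ; ∃; _×_)
open import Data.Sum using (_⊎_)
open import Relation.Binary.PropositionalEquality using (_≡_)

State : ℕ → Set
State n = Vec Bool n

BN : ℕ → Set
BN n = State n → State n

_≤ₛ_ : ∀ {n} → State n → State n → Set
x ≤ₛ y = ∀ i → lookup x i B.≤ lookup y i

Monotone : ∀ {n} → BN n → Set
Monotone f = ∀ x y → x ≤ₛ y → f x ≤ₛ f y

toℤ : Bool → ℤ
toℤ b = if b then + 1 else + 0

deriv : ∀ {n} → BN n → Fin n → Fin n → State n → ℤ
deriv f i j x = toℤ (lookup (f (x [ j ]≔ true)) i) - toℤ (lookup (f (x [ j ]≔ false)) i)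

-- signed arcs j → i of the interaction graph G(f)
PosArc : ∀ {n} → BN n → Fin n → Fin n → Set
PosArc f j i = ∃ λ x → + 0 < deriv f i j x

NegArc : ∀ {n} → BN n → Fin n → Fin n → Set
NegArc f j i = ∃ λ x → deriv f i j x < + 0

Arc : ∀ {n} → BN n → Fin n → Fin n → Set
Arc f j i = PosArc f j i ⊎ NegArc f j i

-- A directed cycle (no repeated vertices, loops allowed) in a digraph
-- given by an arc relation E, listed as v₀ → v₁ → … → v_k → v₀.
IsCycle : ∀ {n} → (Fin n → Fin n → Set) → List (Fin n) → Set
IsCycle E [] = Data.Empty.⊥ where import Data.Empty
IsCycle E (v ∷ vs) = Unique (v ∷ vs) × Linked E ((v ∷ vs) ++ [ v ])

IsTransversal : ∀ {n} → (Fin n → Fin n → Set) → Subset n → Set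
IsTransversal E S = ∀ c → IsCycle E c → Any (λ v → v ∈ S) c

IsTransversalNumber : ∀ {n} → (Fin n → Fin n → Set) → ℕ → Set
IsTransversalNumber {n} E t =
  (Σ (Subset n) λ S → IsTransversal E S × ∣ S ∣ ≡ t) ×
  (∀ S → IsTransversal E S → t ≤ ∣ S ∣)

Disjoint : ∀ {n} → List (Fin n) → List (Fin n) → Set
Disjoint c d = ∀ v → v LM.∈ c → ¬ (v LM.∈ d)
  where open import Relation.Nullary using (¬_)

IsPacking : ∀ {n} → (Fin n → Fin n → Set) → List (List (Fin n)) → Set
IsPacking E cs = All (IsCycle E) cs × AllPairs Disjoint cs

IsPackingNumber : ∀ {n} → (Fin n → Fin n → Set) → ℕ → Set
IsPackingNumber {n} E p =
  (Σ (List (List (Fin n))) λ cs → IsPacking E cs × length cs ≡ p) ×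
  (∀ cs → IsPacking E cs → length cs ≤ p)

allStates : ∀ n → List (State n)
allStates zero = [] ∷ []
allStates (suc n) = map (false ∷_) (allStates n) ++ map (true ∷_) (allStates n)

numFixedPoints : ∀ {n} → BN n → ℕ
numFixedPoints {n} f = length (filter (λ x → ≡-dec B._≟_ (f x) x) (allStates n))

binomials : ℕ → List ℕ
binomials t = map (t C_) (upTo (suc t))

sumLargestBinomials : ℕ → ℕ → ℕ
sumLargestBinomials k t = sum (take k (reverse (sort (binomials t))))

-- Write lfp and gfp for the least and greatest fixed points and I for a minimum transversal of
-- G(f). If x and y are fixed points with x_v = 1 and y_v = 0, raising x ∧ y to x one coordinate at
-- a time switches f_v on at some u with x_u = 1 and y_u = 0, a positive arc u → v; so the vertices
-- where x exceeds y carry a cycle. Two consequences: fixed points are ordered as their restrictions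
-- to I are, and a chain x₀ < x₁ < … < x_k of fixed points yields k disjoint cycles, one in each
-- difference x_{j+1} ∖ x_j. The restrictions of the fixed points other than lfp and gfp therefore
-- form a family of subsets of I without a chain of ν members (lfp and gfp would extend it to ν + 2
-- fixed points), and by Erdős's theorem on such families, proved here with a symmetric chain
-- decomposition of the cube, there are at most as many as the ν - 1 largest binomial coefficients
-- of order τ add up to.

module Submission where

open import Defs
open import Data.Nat using (ℕ; _+_; _∸_; _≤_)

open import Data.Bool using (Bool; true; false; _∧_; _∨_)
import Data.Bool as B
import Data.Bool.Properties as BP
open import Data.Empty using (⊥-elim)
open import Data.Fin using (Fin; zero; suc)
import Data.Fin as F
import Data.Fin.Properties as FP
open import Data.Fin.Subset using (Subset; ∣_∣)
import Data.Integer as ℤ using (+_; _<_; +<+)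
open import Data.List
  using (List; []; _∷_; [_]; _++_; length; map; filter; concat; take; drop; reverse; applyUpTo; allFin)
open import Data.List.Membership.Propositional using (_∈_)
open import Data.List.Membership.Propositional.Properties
  using (∈-∃++; ∈-map⁺; ∈-map⁻; ∈-concat⁺; ∈-filter⁺; ∈-filter⁻; ∈-++⁻; ∈-++⁺ˡ; ∈-++⁺ʳ; ∈-allFin)
import Data.List.Membership.DecPropositional as DecMembership
open import Data.List.Properties
  using (unfold-reverse; length-map; length-++; length-++-sucʳ; length-take; length-tabulate; filter-++; length-filter; map-upTo; take-[]; drop-[]; ++-assoc)
open import Data.List.Relation.Binary.Permutation.Propositional
  using (_↭_; ↭-sym; prep) renaming (trans to ↭-trans; refl to ↭-refl)
open import Data.List.Relation.Binary.Permutation.Propositional.Properties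
  using (drop-mid; ∈-resp-↭; ↭-length; All-resp-↭; ↭-reverse; shift)
open import Data.List.Relation.Binary.Sublist.Propositional using (_⊆_; []; _∷_; _∷ʳ_; ⊆-trans)
open import Data.List.Relation.Binary.Sublist.Propositional.Properties using (take-⊆; drop-⊆)
open import Data.List.Relation.Unary.All as All using (All; []; _∷_)
import Data.List.Relation.Unary.All.Properties as All
open import Data.List.Relation.Unary.AllPairs using (AllPairs; []; _∷_)
import Data.List.Relation.Unary.AllPairs.Properties as AllPairs
open import Data.List.Relation.Unary.Any as Any using (Any; here; there)
import Data.List.Relation.Unary.Any.Properties as Any
open import Data.List.Relation.Unary.Linked using (Linked; []; [-]; _∷_)
import Data.List.Relation.Unary.Linked.Properties as Linked
open import Data.List.Relation.Unary.Unique.Propositional using (Unique)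
import Data.List.Relation.Unary.Unique.Propositional.Properties as Unique
open import Data.Nat using (zero; suc; _⊓_; _<_; _≥_; z≤n; s≤s; ⌊_/2⌋)
open import Data.Nat.Combinatorics using (_C_; nCk+nC[k+1]≡[n+1]C[k+1]; k>n⇒nCk≡0)
open import Data.Nat.ListAction using (sum)
open import Data.Nat.Properties
open import Data.Product using (∃; _×_; _,_; proj₁; proj₂)
open import Data.Sum using (_⊎_; inj₁; inj₂)
open import Function using (_∘_; id)
open import Data.Vec using ([]; _∷_; lookup; _[_]≔_; zipWith; replicate)
open import Data.Vec.Properties
  using (≡-dec; lookup∘update; lookup∘update′; lookup-zipWith; lookup-replicate; []=⇒lookup; ∷-injectiveʳ; tabulate∘lookup; tabulate-cong)
open import Relation.Nullary using (yes; no; ¬_; ¬?; Dec)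
open import Relation.Nullary.Decidable using (_×-dec_)
import Relation.Unary as U
open import Relation.Binary.PropositionalEquality hiding ([_])

open import Algebra.Properties.CommutativeSemigroup +-commutativeSemigroup
  using () renaming (interchange to +-interchange; x∙yz≈y∙xz to +-left-comm)
open import Data.List.Sort.MergeSort.Base ≤-decTotalOrder using (sort)
open import Data.List.Sort.MergeSort.Properties ≤-decTotalOrder using (sort-↭; sort-↗)

unique-⊆⇒length≤ : ∀ {A : Set} (xs ys : List A) → Unique xs → (∀ {x} → x ∈ xs → x ∈ ys) → length xs ≤ length ys
unique-⊆⇒length≤ [] ys _ _ = z≤n
unique-⊆⇒length≤ (x ∷ xs) ys (x∉xs ∷ xs!) xs⊆ys with ∈-∃++ (xs⊆ys (here refl))
... | ys₁ , ys₂ , refl =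
  ≤-trans (s≤s (unique-⊆⇒length≤ xs (ys₁ ++ ys₂) xs! (λ y∈xs → remove (xs⊆ys (there y∈xs)) (All.lookup x∉xs y∈xs ∘ sym))))
          (≤-reflexive (sym (length-++-sucʳ ys₁ x ys₂)))
  where
    remove : ∀ {y} → y ∈ ys₁ ++ x ∷ ys₂ → y ≢ x → y ∈ ys₁ ++ ys₂
    remove y∈ y≢x with ∈-++⁻ ys₁ y∈
    ... | inj₁ y∈ys₁ = ∈-++⁺ˡ y∈ys₁
    ... | inj₂ (here y≡x) = ⊥-elim (y≢x y≡x)
    ... | inj₂ (there y∈ys₂) = ∈-++⁺ʳ ys₁ y∈ys₂

unique-map : ∀ {A B : Set} (g : A → B) (xs : List A) → Unique xs →
             (∀ {a b} → a ∈ xs → b ∈ xs → g a ≡ g b → a ≡ b) → Unique (map g xs)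
unique-map g [] _ _ = []
unique-map g (x ∷ xs) (x∉xs ∷ xs!) g-inj =
  distinct xs x∉xs id ∷ unique-map g xs xs! (λ a∈ b∈ → g-inj (there a∈) (there b∈))
  where
    distinct : ∀ ys → All (x ≢_) ys → (∀ {y} → y ∈ ys → y ∈ xs) → All (g x ≢_) (map g ys)
    distinct [] [] _ = []
    distinct (y ∷ ys) (x≢y ∷ x≢ys) ys⊆xs =
      (x≢y ∘ g-inj (here refl) (there (ys⊆xs (here refl)))) ∷ distinct ys x≢ys (ys⊆xs ∘ there)

unique-++⁻ˡ : ∀ {A : Set} (xs : List A) {ys} → Unique (xs ++ ys) → Unique xs
unique-++⁻ˡ [] _ = []
unique-++⁻ˡ (x ∷ xs) (x∉ ∷ xs!) = All.++⁻ˡ xs x∉ ∷ unique-++⁻ˡ xs xs!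

linked-++⁻ˡ : ∀ {A : Set} {R : A → A → Set} (xs : List A) {ys} → Linked R (xs ++ ys) → Linked R xs
linked-++⁻ˡ [] _ = []
linked-++⁻ˡ (x ∷ []) _ = [-]
linked-++⁻ˡ (x ∷ y ∷ xs) (Rxy ∷ R↗) = Rxy ∷ linked-++⁻ˡ (y ∷ xs) R↗

linked-∷ʳ : ∀ {A : Set} {R : A → A → Set} (xs : List A) {u v} → Linked R (xs ++ [ u ]) → R u v →
            Linked R (xs ++ u ∷ [ v ])
linked-∷ʳ [] _ Ruv = Ruv ∷ [-]
linked-∷ʳ (x ∷ []) (Rxu ∷ _) Ruv = Rxu ∷ Ruv ∷ [-]
linked-∷ʳ (x ∷ y ∷ xs) (Rxy ∷ R↗) Ruv = Rxy ∷ linked-∷ʳ (y ∷ xs) R↗ Ruv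

Descending : List ℕ → Set
Descending = AllPairs _≥_

sum-take-++-∷ : ∀ (xs : List ℕ) d ys k → length xs ≤ k →
                sum (take (suc k) (xs ++ d ∷ ys)) ≡ d + sum (take k (xs ++ ys))
sum-take-++-∷ [] d ys k _ = refl
sum-take-++-∷ (x ∷ xs) d ys (suc k) (s≤s xs≤k) =
  trans (cong (x +_) (sum-take-++-∷ xs d ys k xs≤k)) (+-left-comm x d _)

take-++-prefix : ∀ {A : Set} (xs ys zs : List A) k → k ≤ length xs →
                 take k (xs ++ ys) ≡ take k (xs ++ zs)
take-++-prefix xs ys zs zero _ = refl
take-++-prefix (x ∷ xs) ys zs (suc k) (s≤s k≤xs) = cong (x ∷_) (take-++-prefix xs ys zs k k≤xs)

sum-take-suc-≤ : ∀ d (ds : List ℕ) k → All (_≤ d) ds → sum (take (suc k) ds) ≤ d + sum (take k ds)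
sum-take-suc-≤ d [] k _ = z≤n
sum-take-suc-≤ d (e ∷ es) zero (e≤d ∷ _) = +-monoˡ-≤ 0 e≤d
sum-take-suc-≤ d (e ∷ es) (suc k) (_ ∷ es≤d) =
  ≤-trans (+-monoʳ-≤ e (sum-take-suc-≤ d es k es≤d)) (≤-reflexive (+-left-comm e d _))

-- Exchange argument: the head d of ds is found somewhere in xs; whether or not it lies
-- among the first k+1 entries, the bound reduces to the tail.
sum-take-≤-descending : ∀ ds → Descending ds → ∀ xs → xs ↭ ds → ∀ k → sum (take k xs) ≤ sum (take k ds)
sum-take-≤-descending [] _ [] _ k = ≤-refl
sum-take-≤-descending [] _ (x ∷ xs) xs↭[] k with ↭-length xs↭[]
... | ()
sum-take-≤-descending (d ∷ ds) _ xs _ zero = z≤n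
sum-take-≤-descending (d ∷ ds) (d≥ds ∷ desc) xs xs↭ (suc k)
  with ∈-∃++ (∈-resp-↭ (↭-sym xs↭) (here refl))
... | ys , zs , refl with length ys ≤? k
...   | yes ys≤k = begin
          sum (take (suc k) (ys ++ d ∷ zs)) ≡⟨ sum-take-++-∷ ys d zs k ys≤k ⟩
          d + sum (take k (ys ++ zs))       ≤⟨ +-monoʳ-≤ d (sum-take-≤-descending ds desc (ys ++ zs) (drop-mid ys [] xs↭) k) ⟩
          d + sum (take k ds)               ∎
  where open ≤-Reasoning
...   | no ys≰k = begin
          sum (take (suc k) (ys ++ d ∷ zs)) ≡⟨ cong sum (take-++-prefix ys (d ∷ zs) zs (suc k) (≰⇒> ys≰k)) ⟩
          sum (take (suc k) (ys ++ zs))     ≤⟨ sum-take-≤-descending ds desc (ys ++ zs) (drop-mid ys [] xs↭) (suc k) ⟩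
          sum (take (suc k) ds)             ≤⟨ sum-take-suc-≤ d ds k d≥ds ⟩
          d + sum (take k ds)               ∎
  where open ≤-Reasoning

descending-reverse : ∀ xs → AllPairs _≤_ xs → Descending (reverse xs)
descending-reverse [] [] = []
descending-reverse (x ∷ xs) (x≤xs ∷ xs↗) rewrite unfold-reverse x xs =
  AllPairs.++⁺ (descending-reverse xs xs↗) ([] ∷ [])
    (All.map (_∷ []) (All-resp-↭ (↭-sym (↭-reverse xs)) x≤xs))

⊆⇒++-↭ : ∀ {xs ys : List ℕ} → xs ⊆ ys → ∃ λ zs → xs ++ zs ↭ ys
⊆⇒++-↭ [] = [] , ↭-refl
⊆⇒++-↭ (y ∷ʳ xs⊆ys) with ⊆⇒++-↭ xs⊆ys
... | zs , ↭ys = y ∷ zs , ↭-trans (shift y _ zs) (prep y ↭ys)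
⊆⇒++-↭ (refl ∷ xs⊆ys) with ⊆⇒++-↭ xs⊆ys
... | zs , ↭ys = zs , prep _ ↭ys

sum-take-++-≥ : ∀ (xs ys : List ℕ) k → length xs ≤ k → sum xs ≤ sum (take k (xs ++ ys))
sum-take-++-≥ [] ys k _ = z≤n
sum-take-++-≥ (x ∷ xs) ys (suc k) (s≤s xs≤k) = +-monoʳ-≤ x (sum-take-++-≥ xs ys k xs≤k)

sum-⊆-≤-sumLargest : ∀ {xs ys : List ℕ} k → xs ⊆ ys → length xs ≤ k →
                     sum xs ≤ sum (take k (reverse (sort ys)))
sum-⊆-≤-sumLargest {xs} {ys} k xs⊆ys xs≤k with ⊆⇒++-↭ xs⊆ys
... | zs , ↭ys = ≤-trans (sum-take-++-≥ xs zs k xs≤k)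
  (sum-take-≤-descending (reverse (sort ys))
    (descending-reverse (sort ys) (Linked.Linked⇒AllPairs ≤-trans (sort-↗ ys)))
    (xs ++ zs) (↭-trans ↭ys (↭-sym (↭-trans (↭-reverse (sort ys)) (sort-↭ ys)))) k)

window : (ℕ → ℕ) → ℕ → ℕ → ℕ
window g a zero = 0
window g a (suc m) = g a + window g (suc a) m

window-shift : ∀ g a m → window g (suc a) m ≡ window (λ i → g (suc i)) a m
window-shift g a zero = refl
window-shift g a (suc m) = cong (g (suc a) +_) (window-shift g (suc a) m)

window-vanishing : ∀ g a m → (∀ i → a ≤ i → g i ≡ 0) → window g a m ≡ 0
window-vanishing g a zero _ = refl
window-vanishing g a (suc m) g≡0 rewrite g≡0 a ≤-refl =
  window-vanishing g (suc a) m (λ i a<i → g≡0 i (<⇒≤ a<i))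

window-≡-sum-take-drop : ∀ g n a m → (∀ i → n ≤ i → g i ≡ 0) →
                         window g a m ≡ sum (take m (drop a (applyUpTo g n)))
window-≡-sum-take-drop g zero a m g≡0 rewrite drop-[] {A = ℕ} a | take-[] {A = ℕ} m =
  window-vanishing g a m (λ i _ → g≡0 i z≤n)
window-≡-sum-take-drop g (suc n) (suc a) m g≡0 =
  trans (window-shift g a m) (window-≡-sum-take-drop (λ i → g (suc i)) n a m (λ i n≤i → g≡0 (suc i) (s≤s n≤i)))
window-≡-sum-take-drop g (suc n) zero zero g≡0 = refl
window-≡-sum-take-drop g (suc n) zero (suc m) g≡0 = cong (g 0 +_)
  (trans (window-shift g 0 m) (window-≡-sum-take-drop (λ i → g (suc i)) n 0 m (λ i n≤i → g≡0 (suc i) (s≤s n≤i))))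

window≤sumLargestBinomials : ∀ t a m → window (t C_) a m ≤ sumLargestBinomials m t
window≤sumLargestBinomials t a m = begin
  window (t C_) a m                                      ≡⟨ window-≡-sum-take-drop (t C_) (suc t) a m (λ _ → k>n⇒nCk≡0) ⟩
  sum (take m (drop a coefficients))                     ≤⟨ sum-⊆-≤-sumLargest m sub (≤-trans (≤-reflexive (length-take m _)) (m⊓n≤m m _)) ⟩
  sum (take m (reverse (sort coefficients)))             ≡⟨ cong (λ xs → sum (take m (reverse (sort xs)))) (sym (map-upTo (t C_) (suc t))) ⟩
  sumLargestBinomials m t                                ∎
  where
    open ≤-Reasoning
    coefficients : List ℕ
    coefficients = applyUpTo (t C_) (suc t)
    sub : take m (drop a coefficients) ⊆ coefficients
    sub = ⊆-trans (take-⊆ m _) (drop-⊆ a _)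

window-snoc : ∀ g a m → window g a (suc m) ≡ window g a m + g (a + m)
window-snoc g a zero = trans (+-identityʳ (g a)) (cong g (sym (+-identityʳ a)))
window-snoc g a (suc m) = begin
  g a + window g (suc a) (suc m)          ≡⟨ cong (g a +_) (window-snoc g (suc a) m) ⟩
  g a + (window g (suc a) m + g (suc a + m)) ≡⟨ sym (+-assoc (g a) _ _) ⟩
  g a + window g (suc a) m + g (suc a + m)   ≡⟨ cong (λ i → g a + window g (suc a) m + g i) (sym (+-suc a m)) ⟩
  g a + window g (suc a) m + g (a + suc m)   ∎
  where open ≡-Reasoning

window-pascal : ∀ t b m → window (suc t C_) (suc b) m ≡ window (t C_) b m + window (t C_) (suc b) m
window-pascal t b zero = refl
window-pascal t b (suc m) = begin
  suc t C suc b + window (suc t C_) (suc (suc b)) m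
    ≡⟨ cong₂ _+_ (sym (nCk+nC[k+1]≡[n+1]C[k+1] t b)) (window-pascal t (suc b) m) ⟩
  (t C b + t C suc b) + (window (t C_) (suc b) m + window (t C_) (suc (suc b)) m)
    ≡⟨ +-interchange (t C b) _ _ _ ⟩
  (t C b + window (t C_) (suc b) m) + (t C suc b + window (t C_) (suc (suc b)) m) ∎
  where open ≡-Reasoning

-- The m central binomial coefficients of order t start at ⌊(t+1-m)/2⌋ (truncated subtraction:
-- the window starts at 0 once m ≥ t).
centralStart : ℕ → ℕ → ℕ
centralStart t m = ⌊ (suc t ∸ m) /2⌋

centralStart-< : ∀ t m → m < t → centralStart t m ≡ suc (centralStart t (suc (suc m)))
centralStart-< (suc t) zero _ = refl
centralStart-< (suc t) (suc m) (s≤s m<t) = centralStart-< t m m<t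

centralStart-≥ : ∀ t m → t ≤ m → centralStart t m ≡ 0
centralStart-≥ zero zero _ = refl
centralStart-≥ zero (suc zero) _ = refl
centralStart-≥ zero (suc (suc m)) _ = refl
centralStart-≥ (suc t) (suc m) (s≤s t≤m) = centralStart-≥ t m t≤m

window-pascal-shifted : ∀ t b m → window (suc t C_) (suc b) (suc m) ≡
                        window (t C_) (suc b) m + window (t C_) b (suc (suc m))
window-pascal-shifted t b m = begin
  window (suc t C_) (suc b) (suc m)                           ≡⟨ window-pascal t b (suc m) ⟩
  window (t C_) b (suc m) + window (t C_) (suc b) (suc m)     ≡⟨ cong (window (t C_) b (suc m) +_) (window-snoc (t C_) (suc b) m) ⟩
  window (t C_) b (suc m) + (window (t C_) (suc b) m + t C (suc b + m))
                                                              ≡⟨ +-left-comm (window (t C_) b (suc m)) (window (t C_) (suc b) m) _ ⟩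
  window (t C_) (suc b) m + (window (t C_) b (suc m) + t C (suc b + m))
                                                              ≡⟨ cong (λ i → window (t C_) (suc b) m + (window (t C_) b (suc m) + t C i)) (sym (+-suc b m)) ⟩
  window (t C_) (suc b) m + (window (t C_) b (suc m) + t C (b + suc m))
                                                              ≡⟨ cong (window (t C_) (suc b) m +_) (sym (window-snoc (t C_) b (suc m))) ⟩
  window (t C_) (suc b) m + window (t C_) b (suc (suc m))     ∎
  where open ≡-Reasoning

-- For t ≤ m the coefficient t C (m+1) that the window of width m+2 would add is 0.
window-pascal-initial : ∀ t m → t ≤ m → window (suc t C_) 0 (suc m) ≡
                        window (t C_) 0 m + window (t C_) 0 (suc (suc m))
window-pascal-initial t m t≤m = begin
  1 + window (suc t C_) 1 m                         ≡⟨ cong (1 +_) (window-pascal t 0 m) ⟩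
  1 + (window (t C_) 0 m + window (t C_) 1 m)       ≡⟨ +-left-comm 1 (window (t C_) 0 m) _ ⟩
  window (t C_) 0 m + (1 + window (t C_) 1 m)       ≡⟨ cong (window (t C_) 0 m +_) (sym (+-identityʳ _)) ⟩
  window (t C_) 0 m + (1 + window (t C_) 1 m + 0)   ≡⟨ cong (λ c → window (t C_) 0 m + (1 + window (t C_) 1 m + c)) (sym (k>n⇒nCk≡0 (s≤s t≤m))) ⟩
  window (t C_) 0 m + (1 + window (t C_) 1 m + t C suc m) ≡⟨ cong (window (t C_) 0 m +_) (sym (window-snoc (t C_) 0 (suc m))) ⟩
  window (t C_) 0 m + window (t C_) 0 (suc (suc m)) ∎
  where open ≡-Reasoning

central-window-pascal : ∀ t m → window (suc t C_) (centralStart t m) (suc m) ≡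
  window (t C_) (centralStart t m) m + window (t C_) (centralStart t (suc (suc m))) (suc (suc m))
central-window-pascal t m with m <? t
... | yes m<t rewrite centralStart-< t m m<t = window-pascal-shifted t (centralStart t (suc (suc m))) m
... | no m≮t rewrite centralStart-≥ t m (≮⇒≥ m≮t) | centralStart-≥ t (suc (suc m)) (m≤n⇒m≤1+n (m≤n⇒m≤1+n (≮⇒≥ m≮t))) =
  window-pascal-initial t m (≮⇒≥ m≮t)

module _ {n : ℕ} where

  ≤ₛ-refl : {x : State n} → x ≤ₛ x
  ≤ₛ-refl i = BP.≤-refl

  ≤ₛ-trans : {x y z : State n} → x ≤ₛ y → y ≤ₛ z → x ≤ₛ z
  ≤ₛ-trans x≤y y≤z i = BP.≤-trans (x≤y i) (y≤z i)

  ≗-lookup⇒≡ : {x y : State n} → (∀ i → lookup x i ≡ lookup y i) → x ≡ y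
  ≗-lookup⇒≡ {x} {y} x≗y = trans (sym (tabulate∘lookup x)) (trans (tabulate-cong x≗y) (tabulate∘lookup y))

  ≤ₛ-antisym : {x y : State n} → x ≤ₛ y → y ≤ₛ x → x ≡ y
  ≤ₛ-antisym x≤y y≤x = ≗-lookup⇒≡ (λ i → BP.≤-antisym (x≤y i) (y≤x i))

  _≤ₛ?_ : (x y : State n) → Dec (x ≤ₛ y)
  x ≤ₛ? y = FP.all? (λ i → lookup x i BP.≤? lookup y i)

  data _⊏_ (x y : State n) : Set where
    strict : x ≤ₛ y → ∀ i → lookup x i ≡ false → lookup y i ≡ true → x ⊏ y

true≤⇒true : ∀ {a b} → a B.≤ b → a ≡ true → b ≡ true
true≤⇒true B.b≤b a≡true = a≡true

≤false⇒false : ∀ {a b} → a B.≤ b → b ≡ false → a ≡ false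
≤false⇒false B.b≤b b≡false = b≡false

true≰false : ¬ (true B.≤ false)
true≰false ()

module _ {n : ℕ} where

  ⊏-trans : {x y z : State n} → x ⊏ y → y ⊏ z → x ⊏ z
  ⊏-trans {x} {y} {z} (strict x≤y i xi yi) (strict y≤z _ _ _) =
    strict (≤ₛ-trans {x = x} {y} {z} x≤y y≤z) i xi (true≤⇒true (y≤z i) yi)

  ≤ₛ∧≢⇒⊏ : {x y : State n} → x ≤ₛ y → x ≢ y → x ⊏ y
  ≤ₛ∧≢⇒⊏ {x} {y} x≤y x≢y
    with FP.¬∀⟶∃¬ n _ (λ i → lookup x i B.≟ lookup y i) (x≢y ∘ ≗-lookup⇒≡)
  ... | i , xi≢yi with lookup x i in xi | lookup y i in yi | x≤y i
  ...   | false | true  | _ = strict x≤y i xi yi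
  ...   | false | false | _ = ⊥-elim (xi≢yi refl)
  ...   | true  | true  | _ = ⊥-elim (xi≢yi refl)

  ∷-⊏ : ∀ b {x y : State n} → x ⊏ y → (b ∷ x) ⊏ (b ∷ y)
  ∷-⊏ b {x} {y} (strict x≤y i xi yi) = strict ∷-≤ₛ (suc i) xi yi
    where
      ∷-≤ₛ : (b ∷ x) ≤ₛ (b ∷ y)
      ∷-≤ₛ zero = BP.≤-refl
      ∷-≤ₛ (suc i) = x≤y i

  false∷-⊏-true∷ : (x : State n) → (false ∷ x) ⊏ (true ∷ x)
  false∷-⊏-true∷ x = strict ≤ₛ-head zero refl refl
    where
      ≤ₛ-head : (false ∷ x) ≤ₛ (true ∷ x)
      ≤ₛ-head zero = B.f≤t
      ≤ₛ-head (suc i) = BP.≤-refl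

-- de Bruijn–Tengbergen–Kruyswijk: a chain x₀ ⊏ … ⊏ xₖ below I gives the chains
-- 0x₀ ⊏ … ⊏ 0xₖ ⊏ 1xₖ and 1x₀ ⊏ … ⊏ 1xₖ₋₁ below 1I.
module _ {n : ℕ} where

  longerLift : List (State n) → List (State (suc n))
  longerLift [] = []
  longerLift (x ∷ []) = (false ∷ x) ∷ (true ∷ x) ∷ []
  longerLift (x ∷ y ∷ xs) = (false ∷ x) ∷ longerLift (y ∷ xs)

  shorterLift : List (State n) → List (State (suc n))
  shorterLift [] = []
  shorterLift (x ∷ []) = []
  shorterLift (x ∷ y ∷ xs) = (true ∷ x) ∷ shorterLift (y ∷ xs)

  liftChains : List (List (State n)) → List (List (State (suc n)))
  liftChains [] = []
  liftChains (c ∷ cs) = longerLift c ∷ shorterLift c ∷ liftChains cs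

symmetricChains : ∀ {n} → State n → List (List (State n))
symmetricChains [] = ([] ∷ []) ∷ []
symmetricChains (false ∷ I) = map (map (false ∷_)) (symmetricChains I)
symmetricChains (true ∷ I) = liftChains (symmetricChains I)

module _ {n : ℕ} where

  false∷-∈-longerLift : ∀ {x : State n} c → x ∈ c → (false ∷ x) ∈ longerLift c
  false∷-∈-longerLift (x ∷ []) (here refl) = here refl
  false∷-∈-longerLift (x ∷ y ∷ xs) (here refl) = here refl
  false∷-∈-longerLift (x ∷ y ∷ xs) (there x∈) = there (false∷-∈-longerLift (y ∷ xs) x∈)

  true∷-∈-lifts : ∀ {x : State n} c → x ∈ c → (true ∷ x) ∈ longerLift c ⊎ (true ∷ x) ∈ shorterLift c
  true∷-∈-lifts (x ∷ []) (here refl) = inj₁ (there (here refl))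
  true∷-∈-lifts (x ∷ y ∷ xs) (here refl) = inj₂ (here refl)
  true∷-∈-lifts (x ∷ y ∷ xs) (there x∈) with true∷-∈-lifts (y ∷ xs) x∈
  ... | inj₁ ∈longer = inj₁ (there ∈longer)
  ... | inj₂ ∈shorter = inj₂ (there ∈shorter)

  ∷-∈-liftChains : ∀ b {x : State n} cs → Any (x ∈_) cs → Any ((b ∷ x) ∈_) (liftChains cs)
  ∷-∈-liftChains false (c ∷ cs) (here x∈c) = here (false∷-∈-longerLift c x∈c)
  ∷-∈-liftChains true (c ∷ cs) (here x∈c) with true∷-∈-lifts c x∈c
  ... | inj₁ ∈longer = here ∈longer
  ... | inj₂ ∈shorter = there (here ∈shorter)
  ∷-∈-liftChains b (c ∷ cs) (there x∈cs) = there (there (∷-∈-liftChains b cs x∈cs))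

  linked-longerLift : ∀ (c : List (State n)) → Linked _⊏_ c → Linked _⊏_ (longerLift c)
  linked-longerLift [] _ = []
  linked-longerLift (x ∷ []) _ = false∷-⊏-true∷ x ∷ [-]
  linked-longerLift (x ∷ y ∷ []) (x⊏y ∷ _) = ∷-⊏ false x⊏y ∷ false∷-⊏-true∷ y ∷ [-]
  linked-longerLift (x ∷ y ∷ z ∷ xs) (x⊏y ∷ c↗) = ∷-⊏ false x⊏y ∷ linked-longerLift (y ∷ z ∷ xs) c↗

  linked-shorterLift : ∀ (c : List (State n)) → Linked _⊏_ c → Linked _⊏_ (shorterLift c)
  linked-shorterLift [] _ = []
  linked-shorterLift (x ∷ []) _ = []
  linked-shorterLift (x ∷ y ∷ []) _ = [-]
  linked-shorterLift (x ∷ y ∷ z ∷ xs) (x⊏y ∷ c↗) = ∷-⊏ true x⊏y ∷ linked-shorterLift (y ∷ z ∷ xs) c↗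

  linked-liftChains : ∀ (cs : List (List (State n))) → All (Linked _⊏_) cs → All (Linked _⊏_) (liftChains cs)
  linked-liftChains [] [] = []
  linked-liftChains (c ∷ cs) (c↗ ∷ cs↗) = linked-longerLift c c↗ ∷ linked-shorterLift c c↗ ∷ linked-liftChains cs cs↗

  linked-map-∷ : ∀ b (c : List (State n)) → Linked _⊏_ c → Linked (_⊏_ {suc n}) (map (b ∷_) c)
  linked-map-∷ b [] [] = []
  linked-map-∷ b (x ∷ []) [-] = [-]
  linked-map-∷ b (x ∷ y ∷ xs) (x⊏y ∷ c↗) = ∷-⊏ b x⊏y ∷ linked-map-∷ b (y ∷ xs) c↗

∈-symmetricChains : ∀ {n} (I x : State n) → x ≤ₛ I → Any (x ∈_) (symmetricChains I)
∈-symmetricChains [] [] _ = here (here refl)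
∈-symmetricChains (false ∷ I) (b ∷ x) x≤I with x≤I zero
... | B.b≤b = Any.map⁺ (Any.map (∈-map⁺ (false ∷_)) (∈-symmetricChains I x (x≤I ∘ suc)))
∈-symmetricChains (true ∷ I) (b ∷ x) x≤I = ∷-∈-liftChains b (symmetricChains I) (∈-symmetricChains I x (x≤I ∘ suc))

linked-symmetricChains : ∀ {n} (I : State n) → All (Linked _⊏_) (symmetricChains I)
linked-symmetricChains [] = [-] ∷ []
linked-symmetricChains (false ∷ I) = All.map⁺ (All.map (linked-map-∷ false _) (linked-symmetricChains I))
linked-symmetricChains (true ∷ I) = linked-liftChains (symmetricChains I) (linked-symmetricChains I)

-- Erdős's theorem on families without long chains

truncatedSize : ∀ {A : Set} → List (List A) → ℕ → ℕ
truncatedSize [] m = 0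
truncatedSize (c ∷ cs) m = length c ⊓ m + truncatedSize cs m

truncatedSize-zero : ∀ {A : Set} (cs : List (List A)) → truncatedSize cs 0 ≡ 0
truncatedSize-zero [] = refl
truncatedSize-zero (c ∷ cs) = trans (cong (_+ truncatedSize cs 0) (⊓-zeroʳ (length c))) (truncatedSize-zero cs)

truncatedSize-map-map : ∀ {A B : Set} (g : A → B) (cs : List (List A)) m →
                        truncatedSize (map (map g) cs) m ≡ truncatedSize cs m
truncatedSize-map-map g [] m = refl
truncatedSize-map-map g (c ∷ cs) m = cong₂ _+_ (cong (_⊓ m) (length-map g c)) (truncatedSize-map-map g cs m)

module _ {n : ℕ} where

  length-longerLift : ∀ (x : State n) xs → length (longerLift (x ∷ xs)) ≡ suc (suc (length xs))
  length-longerLift x [] = refl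
  length-longerLift x (y ∷ xs) = cong suc (length-longerLift y xs)

  length-shorterLift : ∀ (x : State n) xs → length (shorterLift (x ∷ xs)) ≡ length xs
  length-shorterLift x [] = refl
  length-shorterLift x (y ∷ xs) = cong suc (length-shorterLift y xs)

  truncated-lifts : ∀ (c : List (State n)) m →
    length (longerLift c) ⊓ suc m + length (shorterLift c) ⊓ suc m ≡ length c ⊓ m + length c ⊓ suc (suc m)
  truncated-lifts [] m = refl
  truncated-lifts (x ∷ xs) m rewrite length-longerLift x xs | length-shorterLift x xs =
    sym (+-suc (suc (length xs) ⊓ m) (length xs ⊓ suc m))

  truncatedSize-liftChains : ∀ (cs : List (List (State n))) m →
    truncatedSize (liftChains cs) (suc m) ≡ truncatedSize cs m + truncatedSize cs (suc (suc m))
  truncatedSize-liftChains [] m = refl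
  truncatedSize-liftChains (c ∷ cs) m = begin
    length (longerLift c) ⊓ suc m + (length (shorterLift c) ⊓ suc m + truncatedSize (liftChains cs) (suc m))
      ≡⟨ sym (+-assoc (length (longerLift c) ⊓ suc m) _ _) ⟩
    (length (longerLift c) ⊓ suc m + length (shorterLift c) ⊓ suc m) + truncatedSize (liftChains cs) (suc m)
      ≡⟨ cong₂ _+_ (truncated-lifts c m) (truncatedSize-liftChains cs m) ⟩
    (length c ⊓ m + length c ⊓ suc (suc m)) + (truncatedSize cs m + truncatedSize cs (suc (suc m)))
      ≡⟨ +-interchange (length c ⊓ m) _ _ _ ⟩
    (length c ⊓ m + truncatedSize cs m) + (length c ⊓ suc (suc m) + truncatedSize cs (suc (suc m))) ∎
    where open ≡-Reasoning

truncatedSize-symmetricChains : ∀ {n} (I : State n) m →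
  truncatedSize (symmetricChains I) m ≡ window (∣ I ∣ C_) (centralStart ∣ I ∣ m) m
truncatedSize-symmetricChains [] zero = refl
truncatedSize-symmetricChains [] (suc zero) = refl
truncatedSize-symmetricChains [] (suc (suc m)) = cong suc (sym (window-vanishing (0 C_) 1 (suc m) (λ { (suc i) _ → refl })))
truncatedSize-symmetricChains (false ∷ I) m =
  trans (truncatedSize-map-map (false ∷_) (symmetricChains I) m) (truncatedSize-symmetricChains I m)
truncatedSize-symmetricChains (true ∷ I) zero = truncatedSize-zero (liftChains (symmetricChains I))
truncatedSize-symmetricChains (true ∷ I) (suc m) = begin
  truncatedSize (liftChains (symmetricChains I)) (suc m)
    ≡⟨ truncatedSize-liftChains (symmetricChains I) m ⟩
  truncatedSize (symmetricChains I) m + truncatedSize (symmetricChains I) (suc (suc m))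
    ≡⟨ cong₂ _+_ (truncatedSize-symmetricChains I m) (truncatedSize-symmetricChains I (suc (suc m))) ⟩
  window (t C_) (centralStart t m) m + window (t C_) (centralStart t (suc (suc m))) (suc (suc m))
    ≡⟨ sym (central-window-pascal t m) ⟩
  window (suc t C_) (centralStart t m) (suc m) ∎
  where
    open ≡-Reasoning
    t : ℕ
    t = ∣ I ∣

module _ {n : ℕ} (F : List (State n)) (m : ℕ)
         (short-chains : ∀ ch → All (_∈ F) ch → Linked _⊏_ ch → length ch ≤ m) where

  private
    open DecMembership (≡-dec {n = n} B._≟_) using (_∈?_)

    _∈F? : U.Decidable (_∈ F)
    x ∈F? = x ∈? F

  length-filter-concat≤truncatedSize : ∀ cs → All (Linked _⊏_) cs →
                                       length (filter _∈F? (concat cs)) ≤ truncatedSize cs m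
  length-filter-concat≤truncatedSize [] [] = z≤n
  length-filter-concat≤truncatedSize (c ∷ cs) (c↗ ∷ cs↗)
    rewrite filter-++ _∈F? c (concat cs) | length-++ (filter _∈F? c) {filter _∈F? (concat cs)} =
    +-mono-≤ (⊓-glb (length-filter _∈F? c)
                    (short-chains (filter _∈F? c) (All.all-filter _∈F? c) (Linked.filter⁺ _∈F? ⊏-trans c↗)))
             (length-filter-concat≤truncatedSize cs cs↗)

  -- Erdős: the symmetric chains partition the states below I, and F meets each in at most m states.
  length≤sumLargestBinomials : ∀ (I : State n) → Unique F → All (_≤ₛ I) F →
                               length F ≤ sumLargestBinomials m ∣ I ∣
  length≤sumLargestBinomials I F! F≤I = begin
    length F                                                    ≤⟨ unique-⊆⇒length≤ F _ F! F⊆ ⟩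
    length (filter _∈F? (concat (symmetricChains I)))           ≤⟨ length-filter-concat≤truncatedSize (symmetricChains I) (linked-symmetricChains I) ⟩
    truncatedSize (symmetricChains I) m                         ≡⟨ truncatedSize-symmetricChains I m ⟩
    window (∣ I ∣ C_) (centralStart ∣ I ∣ m) m                  ≤⟨ window≤sumLargestBinomials ∣ I ∣ _ m ⟩
    sumLargestBinomials m ∣ I ∣                                 ∎
    where
      open ≤-Reasoning
      F⊆ : ∀ {x} → x ∈ F → x ∈ filter _∈F? (concat (symmetricChains I))
      F⊆ {x} x∈F = ∈-filter⁺ _∈F? (∈-concat⁺ (∈-symmetricChains I x (All.lookup F≤I x∈F))) x∈F

unique-length≤ : ∀ {n} (xs : List (Fin n)) → Unique xs → length xs ≤ n
unique-length≤ {n} xs xs! = begin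
  length xs        ≤⟨ unique-⊆⇒length≤ xs (allFin n) xs! (λ {x} _ → ∈-allFin x) ⟩
  length (allFin n) ≡⟨ length-tabulate _ ⟩
  n                ∎
  where open ≤-Reasoning

-- Walking backwards along predecessors inside P must revisit a vertex after at most n steps.
module _ {n : ℕ} (E : Fin n → Fin n → Set) (P : Fin n → Set)
         (predecessor : ∀ {v} → P v → ∃ λ u → E u v × P u) where

  private
    open DecMembership (F._≟_ {n}) using (_∈?_)

    Path : List (Fin n) → Set
    Path p = Unique p × Linked E p × All P p

    cycle-closing : ∀ h t u → Path (h ∷ t) → E u h → u ∈ h ∷ t → ∃ λ c → IsCycle E c × All P c
    cycle-closing h t u (_ , _ , Ph ∷ _) Euh (here refl) = [ u ] , ([] ∷ [] , Euh ∷ [-]) , Ph ∷ []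
    cycle-closing h t u (h∷t! , h∷t↗ , Ph∷t) Euh (there u∈t) with ∈-∃++ u∈t
    ... | pre , post , refl =
      (h ∷ pre ++ [ u ]) ,
      (unique-++⁻ˡ (h ∷ pre ++ [ u ]) (subst Unique split h∷t!) ,
       subst (Linked E) (cong (h ∷_) (sym (++-assoc pre [ u ] [ h ])))
         (linked-∷ʳ (h ∷ pre) (linked-++⁻ˡ (h ∷ pre ++ [ u ]) (subst (Linked E) split h∷t↗)) Euh)) ,
      All.++⁻ˡ (h ∷ pre ++ [ u ]) (subst (All P) split Ph∷t)
      where
        split : h ∷ pre ++ u ∷ post ≡ (h ∷ pre ++ [ u ]) ++ post
        split = cong (h ∷_) (sym (++-assoc pre [ u ] post))

    walk : ∀ fuel h t → length (h ∷ t) + fuel ≡ suc n → Path (h ∷ t) → ∃ λ c → IsCycle E c × All P c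
    walk zero h t len≡ (h∷t! , _) =
      ⊥-elim (<-irrefl refl (≤-trans (≤-reflexive (trans (sym len≡) (+-identityʳ _))) (unique-length≤ (h ∷ t) h∷t!)))
    walk (suc fuel) h t len≡ path@(h∷t! , h∷t↗ , Ph∷t) with predecessor (All.head Ph∷t)
    ... | u , Euh , Pu with u ∈? h ∷ t
    ...   | yes u∈ = cycle-closing h t u path Euh u∈
    ...   | no u∉ = walk fuel u (h ∷ t) (trans (sym (+-suc _ fuel)) len≡)
                      (All.¬Any⇒All¬ (h ∷ t) u∉ ∷ h∷t! , Euh ∷ h∷t↗ , Pu ∷ Ph∷t)

  cycle-inside : ∀ {v} → P v → ∃ λ c → IsCycle E c × All P c
  cycle-inside {v} Pv = walk n v [] refl ([] ∷ [] , [-] , Pv ∷ [])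

-- Least and greatest fixed points

∧-≤ˡ : ∀ a b → (a ∧ b) B.≤ a
∧-≤ˡ false b = B.b≤b
∧-≤ˡ true false = B.f≤t
∧-≤ˡ true true = B.b≤b

∧-≤ʳ : ∀ a b → (a ∧ b) B.≤ b
∧-≤ʳ false false = B.b≤b
∧-≤ʳ false true = B.f≤t
∧-≤ʳ true b = B.b≤b

∧-glb : ∀ {a b c} → a B.≤ b → a B.≤ c → a B.≤ (b ∧ c)
∧-glb {false} _ _ = BP.≤-minimum _
∧-glb {true} B.b≤b B.b≤b = B.b≤b

∨-≥ˡ : ∀ a b → a B.≤ (a ∨ b)
∨-≥ˡ false b = BP.≤-minimum _
∨-≥ˡ true b = B.b≤b

∨-≥ʳ : ∀ a b → b B.≤ (a ∨ b)
∨-≥ʳ a false = BP.≤-minimum _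
∨-≥ʳ false true = B.b≤b
∨-≥ʳ true true = B.b≤b

∨-lub : ∀ {a b c} → b B.≤ a → c B.≤ a → (b ∨ c) B.≤ a
∨-lub {true} _ _ = BP.≤-maximum _
∨-lub {false} B.b≤b B.b≤b = B.b≤b

module _ {n : ℕ} where

  ⋀ : List (State n) → State n
  ⋀ [] = replicate n true
  ⋀ (x ∷ xs) = zipWith _∧_ x (⋀ xs)

  ⋁ : List (State n) → State n
  ⋁ [] = replicate n false
  ⋁ (x ∷ xs) = zipWith _∨_ x (⋁ xs)

  ⋀-lowerBound : ∀ {x} xs → x ∈ xs → ⋀ xs ≤ₛ x
  ⋀-lowerBound (y ∷ ys) (here refl) i rewrite lookup-zipWith _∧_ i y (⋀ ys) = ∧-≤ˡ _ _
  ⋀-lowerBound (y ∷ ys) (there x∈) i rewrite lookup-zipWith _∧_ i y (⋀ ys) =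
    BP.≤-trans (∧-≤ʳ _ _) (⋀-lowerBound ys x∈ i)

  ⋀-greatest : ∀ {z} xs → All (z ≤ₛ_) xs → z ≤ₛ ⋀ xs
  ⋀-greatest [] [] i rewrite lookup-replicate i true = BP.≤-maximum _
  ⋀-greatest {z} (y ∷ ys) (z≤y ∷ z≤ys) i rewrite lookup-zipWith _∧_ i y (⋀ ys) =
    ∧-glb (z≤y i) (⋀-greatest {z} ys z≤ys i)

  ⋁-upperBound : ∀ {x} xs → x ∈ xs → x ≤ₛ ⋁ xs
  ⋁-upperBound (y ∷ ys) (here refl) i rewrite lookup-zipWith _∨_ i y (⋁ ys) = ∨-≥ˡ _ _
  ⋁-upperBound (y ∷ ys) (there x∈) i rewrite lookup-zipWith _∨_ i y (⋁ ys) =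
    BP.≤-trans (⋁-upperBound ys x∈ i) (∨-≥ʳ _ _)

  ⋁-least : ∀ {z} xs → All (_≤ₛ z) xs → ⋁ xs ≤ₛ z
  ⋁-least [] [] i rewrite lookup-replicate i false = BP.≤-minimum _
  ⋁-least {z} (y ∷ ys) (y≤z ∷ ys≤z) i rewrite lookup-zipWith _∨_ i y (⋁ ys) =
    ∨-lub (y≤z i) (⋁-least {z} ys ys≤z i)

∈-allStates : ∀ n (x : State n) → x ∈ allStates n
∈-allStates zero [] = here refl
∈-allStates (suc n) (false ∷ x) = ∈-++⁺ˡ (∈-map⁺ (false ∷_) (∈-allStates n x))
∈-allStates (suc n) (true ∷ x) = ∈-++⁺ʳ _ (∈-map⁺ (true ∷_) (∈-allStates n x))

unique-allStates : ∀ n → Unique (allStates n)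
unique-allStates zero = [] ∷ []
unique-allStates (suc n) =
  Unique.++⁺ (Unique.map⁺ ∷-injectiveʳ (unique-allStates n)) (Unique.map⁺ ∷-injectiveʳ (unique-allStates n)) disjoint
  where
    disjoint : ∀ {x} → ¬ (x ∈ map (false ∷_) (allStates n) × x ∈ map (true ∷_) (allStates n))
    disjoint (x∈₀ , x∈₁) with ∈-map⁻ (false ∷_) x∈₀ | ∈-map⁻ (true ∷_) x∈₁
    ... | _ , _ , refl | _ , _ , ()

-- Knaster–Tarski on the finite lattice {0,1}ⁿ: the meet of the states x with f x ≤ x is the least
-- fixed point, and dually.
module FixedPoints {n : ℕ} (f : BN n) (mono : Monotone f) where

  Fixed : State n → Set
  Fixed x = f x ≡ x

  fixed⇒≤ₛ : ∀ {x} → Fixed x → f x ≤ₛ x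
  fixed⇒≤ₛ fx i = BP.≤-reflexive (cong (λ s → lookup s i) fx)

  fixed⇒≥ₛ : ∀ {x} → Fixed x → x ≤ₛ f x
  fixed⇒≥ₛ fx i = BP.≤-reflexive (cong (λ s → lookup s i) (sym fx))

  private
    prefixedPoints : List (State n)
    prefixedPoints = filter (λ x → f x ≤ₛ? x) (allStates n)

    postfixedPoints : List (State n)
    postfixedPoints = filter (λ x → x ≤ₛ? f x) (allStates n)

  lfp : State n
  lfp = ⋀ prefixedPoints

  gfp : State n
  gfp = ⋁ postfixedPoints

  private
    lfp-≤ₛ-prefixed : ∀ x → f x ≤ₛ x → lfp ≤ₛ x
    lfp-≤ₛ-prefixed x fx≤x = ⋀-lowerBound prefixedPoints (∈-filter⁺ (λ x → f x ≤ₛ? x) (∈-allStates n x) fx≤x)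

    f-lfp≤lfp : f lfp ≤ₛ lfp
    f-lfp≤lfp = ⋀-greatest {z = f lfp} prefixedPoints (All.tabulate λ {x} x∈ →
      ≤ₛ-trans {x = f lfp} {f x} {x} (mono lfp x (⋀-lowerBound prefixedPoints x∈))
        (proj₂ (∈-filter⁻ (λ x → f x ≤ₛ? x) {xs = allStates n} x∈)))

    postfixed-≤ₛ-gfp : ∀ x → x ≤ₛ f x → x ≤ₛ gfp
    postfixed-≤ₛ-gfp x x≤fx = ⋁-upperBound postfixedPoints (∈-filter⁺ (λ x → x ≤ₛ? f x) (∈-allStates n x) x≤fx)

    gfp≤f-gfp : gfp ≤ₛ f gfp
    gfp≤f-gfp = ⋁-least {z = f gfp} postfixedPoints (All.tabulate λ {x} x∈ →
      ≤ₛ-trans {x = x} {f x} {f gfp} (proj₂ (∈-filter⁻ (λ x → x ≤ₛ? f x) {xs = allStates n} x∈))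
        (mono x gfp (⋁-upperBound postfixedPoints x∈)))

  lfp-fixed : Fixed lfp
  lfp-fixed = ≤ₛ-antisym f-lfp≤lfp (lfp-≤ₛ-prefixed (f lfp) (mono _ _ f-lfp≤lfp))

  lfp-least : ∀ {x} → Fixed x → lfp ≤ₛ x
  lfp-least {x} fx = lfp-≤ₛ-prefixed x (fixed⇒≤ₛ fx)

  gfp-fixed : Fixed gfp
  gfp-fixed = ≤ₛ-antisym (postfixed-≤ₛ-gfp (f gfp) (mono _ _ gfp≤f-gfp)) gfp≤f-gfp

  gfp-greatest : ∀ {x} → Fixed x → x ≤ₛ gfp
  gfp-greatest {x} fx = postfixed-≤ₛ-gfp x (fixed⇒≥ₛ fx)

lookup-update : ∀ {n} (w : State n) u b i →
                (u ≡ i × lookup (w [ u ]≔ b) i ≡ b) ⊎ (i ≢ u × lookup (w [ u ]≔ b) i ≡ lookup w i)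
lookup-update w u b i with i F.≟ u
... | yes refl = inj₁ (refl , lookup∘update i w b)
... | no i≢u = inj₂ (i≢u , lookup∘update′ i≢u w b)

update-≤ₛ : ∀ {n} (w : State n) u {b} → b B.≤ lookup w u → (w [ u ]≔ b) ≤ₛ w
update-≤ₛ w u {b} b≤wu i with lookup-update w u b i
... | inj₁ (refl , wi≡b) rewrite wi≡b = b≤wu
... | inj₂ (_ , wi≡) rewrite wi≡ = BP.≤-refl

-- Raise z to x one coordinate at a time: a monotone g that is 0 at z and 1 at x switches
-- on at some coordinate u where z and x differ.
module _ {n : ℕ} (g : State n → Bool) (g-mono : ∀ s t → s ≤ₛ t → g s B.≤ g t)
         (z x : State n) (z≤x : z ≤ₛ x) (gz≡false : g z ≡ false) where

  private
    raise : List (Fin n) → State n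
    raise [] = z
    raise (u ∷ us) = raise us [ u ]≔ lookup x u

    z≤raise : ∀ us → z ≤ₛ raise us
    z≤raise [] = ≤ₛ-refl {x = z}
    z≤raise (u ∷ us) i with lookup-update (raise us) u (lookup x u) i
    ... | inj₁ (refl , ≡xi) rewrite ≡xi = z≤x u
    ... | inj₂ (_ , ≡raise) rewrite ≡raise = z≤raise us i

    lookup-raise : ∀ us {i} → i ∈ us → lookup (raise us) i ≡ lookup x i
    lookup-raise (u ∷ us) {i} i∈ with lookup-update (raise us) u (lookup x u) i
    lookup-raise (u ∷ us) {i} _ | inj₁ (refl , ≡xi) = ≡xi
    lookup-raise (u ∷ us) (here refl) | inj₂ (i≢u , _) = ⊥-elim (i≢u refl)
    lookup-raise (u ∷ us) (there i∈) | inj₂ (_ , ≡raise) = trans ≡raise (lookup-raise us i∈)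

    switch : ∀ us → g (raise us) ≡ true →
             ∃ λ u → ∃ λ w → lookup z u ≡ false × lookup x u ≡ true ×
                             g (w [ u ]≔ true) ≡ true × g (w [ u ]≔ false) ≡ false
    switch [] g≡true with trans (sym gz≡false) g≡true
    ... | ()
    switch (u ∷ us) g≡true with g (raise us) in g≡
    ... | true = switch us g≡
    ... | false with lookup x u in xu | lookup z u in zu
    ...   | false | _ = ⊥-elim (true≰false (subst₂ B._≤_ g≡true g≡ (g-mono _ _ (update-≤ₛ (raise us) u (BP.≤-minimum _)))))
    ...   | true | false = u , raise us , zu , xu , g≡true , ≤false⇒false (g-mono _ _ (update-≤ₛ (raise us) u (BP.≤-minimum _))) g≡
    ...   | true | true = ⊥-elim (true≰false (subst₂ B._≤_ g≡true g≡
                            (g-mono _ _ (update-≤ₛ (raise us) u (subst (B._≤ lookup (raise us) u) zu (z≤raise us u))))))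

  monotone-switch : g x ≡ true →
                    ∃ λ u → ∃ λ w → lookup z u ≡ false × lookup x u ≡ true ×
                                    g (w [ u ]≔ true) ≡ true × g (w [ u ]≔ false) ≡ false
  monotone-switch gx≡true = switch (allFin n) (true≤⇒true (g-mono x _ x≤raise) gx≡true)
    where
      x≤raise : x ≤ₛ raise (allFin n)
      x≤raise i = BP.≤-reflexive (sym (lookup-raise (allFin n) (∈-allFin i)))

module Interaction {n : ℕ} (f : BN n) (mono : Monotone f) where

  open FixedPoints f mono

  Difference : State n → State n → Fin n → Set
  Difference x y v = lookup x v ≡ true × lookup y v ≡ false

  -- Compare f at x ∧ y ≤ x, where component v is 0 (as in y), with f at x, where it is 1.
  positiveArc-into-difference : ∀ {x y} → Fixed x → Fixed y → ∀ {v} → Difference x y v →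
                                ∃ λ u → Arc f u v × Difference x y u
  positiveArc-into-difference {x} {y} fx fy {v} (xv , yv)
    with monotone-switch (λ s → lookup (f s) v) (λ s t s≤t → mono s t s≤t v) z x z≤x fz≡false
           (trans (cong (λ s → lookup s v) fx) xv)
    where
      z : State n
      z = zipWith _∧_ x y
      z≤x : z ≤ₛ x
      z≤x i rewrite lookup-zipWith _∧_ i x y = ∧-≤ˡ _ _
      z≤y : z ≤ₛ y
      z≤y i rewrite lookup-zipWith _∧_ i x y = ∧-≤ʳ _ _
      fz≡false : lookup (f z) v ≡ false
      fz≡false = ≤false⇒false (mono z y z≤y v) (trans (cong (λ s → lookup s v) fy) yv)
  ... | u , w , zu , xu , f₁ , f₀ = u , inj₁ (w , positive) , xu , yu
    where
      yu : lookup y u ≡ false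
      yu = trans (sym (cong (_∧ lookup y u) xu)) (trans (sym (lookup-zipWith _∧_ u x y)) zu)
      positive : ℤ.+ 0 ℤ.< deriv f v u w
      positive rewrite f₁ | f₀ = ℤ.+<+ (s≤s z≤n)

  cycle-in-difference : ∀ {x y} → Fixed x → Fixed y → ∀ {v} → Difference x y v →
                        ∃ λ c → IsCycle (Arc f) c × All (Difference x y) c
  cycle-in-difference {x} {y} fx fy = cycle-inside (Arc f) (Difference x y) (positiveArc-into-difference fx fy)

  -- A coordinate where x exceeds y lies on a cycle of such coordinates, and the transversal meets it.
  ≤ₛ-on-transversal⇒≤ₛ : ∀ (I : Subset n) → IsTransversal (Arc f) I → ∀ {x y} → Fixed x → Fixed y →
                          (∀ i → lookup I i ≡ true → lookup x i B.≤ lookup y i) → x ≤ₛ y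
  ≤ₛ-on-transversal⇒≤ₛ I I-transversal {x} {y} fx fy x≤y-on-I i with lookup x i in xi | lookup y i in yi
  ... | false | _ = BP.≤-minimum _
  ... | true | true = B.b≤b
  ... | true | false with cycle-in-difference fx fy (xi , yi)
  ...   | c , c-cycle , c-difference with All.lookupAny c-difference (I-transversal c c-cycle)
  ...     | (xv , yv) , v∈I = ⊥-elim (true≰false (subst₂ B._≤_ xv yv (x≤y-on-I _ ([]=⇒lookup v∈I))))

  -- The cycles found in the differences of consecutive members of a chain are disjoint, since
  -- the vertices of later cycles are 0 at the earlier members.
  chain⇒packing : ∀ h t → All Fixed (h ∷ t) → Linked _⊏_ (h ∷ t) →
                  ∃ λ cs → IsPacking (Arc f) cs × length cs ≡ length t × All (All (λ v → lookup h v ≡ false)) cs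
  chain⇒packing h [] _ _ = [] , ([] , []) , refl , []
  chain⇒packing h (y ∷ t) (fh ∷ fy∷t) (strict h≤y i hi yi ∷ y∷t↗)
    with chain⇒packing y t fy∷t y∷t↗ | cycle-in-difference (All.head fy∷t) fh (yi , hi)
  ... | cs , (cs-cycles , cs-disjoint) , length≡ , cs-off-y | c , c-cycle , c-difference =
    c ∷ cs , (c-cycle ∷ cs-cycles , All.map disjoint cs-off-y ∷ cs-disjoint) , cong suc length≡ ,
    All.map proj₂ c-difference ∷ All.map (All.map (≤false⇒false (h≤y _))) cs-off-y
    where
      disjoint : ∀ {d} → All (λ v → lookup y v ≡ false) d → Disjoint c d
      disjoint d-off-y v v∈c v∈d with () ← trans (sym (proj₁ (All.lookup c-difference v∈c))) (All.lookup d-off-y v∈d)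

module Counting {n : ℕ} (f : BN n) (mono : Monotone f) where

  open FixedPoints f mono
  open Interaction f mono

  fixed? : U.Decidable Fixed
  fixed? x = ≡-dec B._≟_ (f x) x

  fixedPoints : List (State n)
  fixedPoints = filter fixed? (allStates n)

  Inner : State n → Set
  Inner x = x ≢ lfp × x ≢ gfp

  inner? : U.Decidable Inner
  inner? x = ¬? (≡-dec B._≟_ x lfp) ×-dec ¬? (≡-dec B._≟_ x gfp)

  innerFixedPoints : List (State n)
  innerFixedPoints = filter inner? fixedPoints

  ∈-innerFixedPoints⁻ : ∀ {x} → x ∈ innerFixedPoints → Fixed x × Inner x
  ∈-innerFixedPoints⁻ x∈ with ∈-filter⁻ inner? {xs = fixedPoints} x∈
  ... | x∈fixed , x-inner = proj₂ (∈-filter⁻ fixed? {xs = allStates n} x∈fixed) , x-inner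

  numFixedPoints≤2+inner : numFixedPoints f ≤ 2 + length innerFixedPoints
  numFixedPoints≤2+inner =
    unique-⊆⇒length≤ fixedPoints (lfp ∷ gfp ∷ innerFixedPoints) (Unique.filter⁺ fixed? (unique-allStates n)) ⊆
    where
      ⊆ : ∀ {x} → x ∈ fixedPoints → x ∈ lfp ∷ gfp ∷ innerFixedPoints
      ⊆ {x} x∈ with ≡-dec B._≟_ x lfp | ≡-dec B._≟_ x gfp
      ... | yes x≡lfp | _ = here x≡lfp
      ... | no _ | yes x≡gfp = there (here x≡gfp)
      ... | no x≢lfp | no x≢gfp = there (there (∈-filter⁺ inner? x∈ (x≢lfp , x≢gfp)))

  module Restriction (I : Subset n) (I-transversal : IsTransversal (Arc f) I) where

    restrict : State n → State n
    restrict x = zipWith _∧_ I x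

    restrict-≤ₛ : ∀ x → restrict x ≤ₛ I
    restrict-≤ₛ x i rewrite lookup-zipWith _∧_ i I x = ∧-≤ˡ _ _

    restrict-reflects-≤ₛ : ∀ {x y} → Fixed x → Fixed y → restrict x ≤ₛ restrict y → x ≤ₛ y
    restrict-reflects-≤ₛ {x} {y} fx fy rx≤ry = ≤ₛ-on-transversal⇒≤ₛ I I-transversal fx fy ≤-on-I
      where
        ≤-on-I : ∀ i → lookup I i ≡ true → lookup x i B.≤ lookup y i
        ≤-on-I i Ii with rx≤ry i
        ... | ≤ rewrite lookup-zipWith _∧_ i I x | lookup-zipWith _∧_ i I y | Ii = ≤

    restrict-reflects-⊏ : ∀ {x y} → Fixed x → Fixed y → restrict x ⊏ restrict y → x ⊏ y
    restrict-reflects-⊏ {x} {y} fx fy (strict rx≤ry i rxi ryi)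
      rewrite lookup-zipWith _∧_ i I x | lookup-zipWith _∧_ i I y with lookup I i
    ... | true = strict (restrict-reflects-≤ₛ fx fy rx≤ry) i rxi ryi

    restricted : List (State n)
    restricted = map restrict innerFixedPoints

    unique-restricted : Unique restricted
    unique-restricted = unique-map restrict innerFixedPoints
      (Unique.filter⁺ inner? (Unique.filter⁺ fixed? (unique-allStates n)))
      λ x∈ y∈ rx≡ry → ≤ₛ-antisym
        (restrict-reflects-≤ₛ (proj₁ (∈-innerFixedPoints⁻ x∈)) (proj₁ (∈-innerFixedPoints⁻ y∈))
          (λ i → BP.≤-reflexive (cong (λ s → lookup s i) rx≡ry)))
        (restrict-reflects-≤ₛ (proj₁ (∈-innerFixedPoints⁻ y∈)) (proj₁ (∈-innerFixedPoints⁻ x∈))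
          (λ i → BP.≤-reflexive (cong (λ s → lookup s i) (sym rx≡ry))))

    -- The lifted chain is closed off by gfp, whence its length suc (suc (length ch)).
    lift-chain : ∀ a c ch → All (_∈ restricted) (c ∷ ch) → Linked _⊏_ (c ∷ ch) →
                 (∀ {x} → x ∈ innerFixedPoints → restrict x ≡ c → a ⊏ x) →
                 ∃ λ xs → Linked _⊏_ (a ∷ xs) × All Fixed xs × length xs ≡ suc (suc (length ch))
    lift-chain a c [] (c∈ ∷ []) _ a⊏ with ∈-map⁻ restrict c∈
    ... | x , x∈ , refl with ∈-innerFixedPoints⁻ x∈
    ...   | fx , _ , x≢gfp =
      x ∷ gfp ∷ [] , (a⊏ x∈ refl ∷ ≤ₛ∧≢⇒⊏ (gfp-greatest fx) x≢gfp ∷ [-]) , fx ∷ gfp-fixed ∷ [] , refl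
    lift-chain a c (c′ ∷ ch) (c∈ ∷ ch∈) (c⊏c′ ∷ ch↗) a⊏ with ∈-map⁻ restrict c∈
    ... | x , x∈ , refl with lift-chain x c′ ch ch∈ ch↗ (λ x′∈ rx′≡c′ → restrict-reflects-⊏
                               (proj₁ (∈-innerFixedPoints⁻ x∈)) (proj₁ (∈-innerFixedPoints⁻ x′∈))
                               (subst (restrict x ⊏_) (sym rx′≡c′) c⊏c′))
    ...   | xs , x∷xs↗ , fxs , length≡ =
      x ∷ xs , (a⊏ x∈ refl ∷ x∷xs↗) , proj₁ (∈-innerFixedPoints⁻ x∈) ∷ fxs , cong suc length≡

    restricted-chains-short : ∀ {ν} → (∀ cs → IsPacking (Arc f) cs → length cs ≤ ν) →
                              ∀ ch → All (_∈ restricted) ch → Linked _⊏_ ch → length ch ≤ ν ∸ 1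
    restricted-chains-short packing≤ν [] _ _ = z≤n
    restricted-chains-short packing≤ν (c ∷ ch) ch∈ ch↗ with lift-chain lfp c ch ch∈ ch↗ lfp⊏
      where
        lfp⊏ : ∀ {x} → x ∈ innerFixedPoints → restrict x ≡ c → lfp ⊏ x
        lfp⊏ x∈ _ with ∈-innerFixedPoints⁻ x∈
        ... | fx , x≢lfp , _ = ≤ₛ∧≢⇒⊏ (lfp-least fx) (x≢lfp ∘ sym)
    ... | xs , lfp∷xs↗ , fxs , length≡ with chain⇒packing lfp xs (lfp-fixed ∷ fxs) lfp∷xs↗
    ...   | cs , cs-packing , cs-length , _ =
      ∸-monoˡ-≤ 1 (subst (_≤ _) (trans cs-length length≡) (packing≤ν cs cs-packing))

mainTheorem2 : ∀ n (f : BN n) → Monotone f → ∀ τ ν →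
    IsTransversalNumber (Arc f) τ → IsPackingNumber (Arc f) ν →
    numFixedPoints f ≤ 2 + sumLargestBinomials (ν ∸ 1) τ
mainTheorem2 n f mono τ ν ((I , I-transversal , ∣I∣≡τ) , _) (_ , packing≤ν) = begin
  numFixedPoints f                       ≤⟨ numFixedPoints≤2+inner ⟩
  2 + length innerFixedPoints            ≡⟨ cong (2 +_) (sym (length-map restrict innerFixedPoints)) ⟩
  2 + length restricted                  ≤⟨ +-monoʳ-≤ 2 (length≤sumLargestBinomials restricted (ν ∸ 1)
                                              (restricted-chains-short packing≤ν) I unique-restricted restricted≤I) ⟩
  2 + sumLargestBinomials (ν ∸ 1) ∣ I ∣  ≡⟨ cong (λ t → 2 + sumLargestBinomials (ν ∸ 1) t) ∣I∣≡τ ⟩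
  2 + sumLargestBinomials (ν ∸ 1) τ      ∎
  where
    open ≤-Reasoning
    open Counting f mono
    open Restriction I I-transversal
    restricted≤I : All (_≤ₛ I) restricted
    restricted≤I = All.map⁺ (All.tabulate (λ {x} _ → restrict-≤ₛ x))
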